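{- Let $\mathsf{P}$ be a program, $\mathsf{Gr(P)}$ its ground instantiation, and $\mathcal{M}_\mathsf{Gr(P)}$ the $\leq$-minimum model of $\mathsf{Gr(P)}$. For every argument type $\rho$ and every ground term $\mathsf{E}\in U_{\mathsf{P},\rho}$: (1) there exists $e\in[\![\rho]\!]$ such that $e \lhd_\rho \mathsf{E}$; (2) for all $e,e'\in[\![\rho]\!]$ and all $\mathsf{E}'\in U_{\mathsf{P},\rho}$, if $e\lhd_\rho\mathsf{E}$, $e'\lhd_\rho\mathsf{E}'$ and $e\sqsubseteq_\rho e'$, then $\mathsf{E}\preceq_\rho\mathsf{E}'$.
   Context: Types: functional $\sigma ::= \iota \mid (\iota\to\sigma)$; predicate $\pi ::= o \mid (\rho\to\pi)$; argument $\rho ::= \iota\mid\pi$. The language has predicate variables/constants of every predicate type, individual variables/constants of type $\iota$, function symbols of types $\iota^n\to\iota$ ($n\ge1$) and equality $\approx$ on $\iota$. Terms: variables and constants; $(\mathsf{f}\,\mathsf{E}_1\cdots\mathsf{E}_n):\iota$ for $\mathsf{E}_i:\iota$; $(\mathsf{E}_1\,\mathsf{E}_2):\pi$ for $\mathsf{E}_1:\rho\to\pi$, $\mathsf{E}_2:\rho$. Expressions: terms of argument type and $(\mathsf{E}_1\approx\mathsf{E}_2):o$ for terms of type $\iota$. A program $\mathsf{P}$ is a set of definitional clauses $\mathsf{p}\,\mathsf{V}_1\cdots\mathsf{V}_n\leftarrow\mathsf{E}_1,\dots,\mathsf{E}_m$ ($\mathsf{p}$ a predicate constant, head a term of type $o$,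 body expressions of type $o$, the $\mathsf{V}_i$ pairwise distinct variables, body variables among the $\mathsf{V}_i$ plus individual variables). $U_{\mathsf{P},\rho}$: ground terms of type $\rho$ built from the constants and function symbols of $\mathsf{P}$. $\mathsf{Gr(P)}$ is the set of all ground instances $(\mathsf{p}\,\mathsf{V}_1\cdots\mathsf{V}_n)\theta\leftarrow\mathsf{E}_1\theta,\dots,\mathsf{E}_m\theta$ of clauses of $\mathsf{P}$ under ground substitutions $\theta$ covering all clause variables. An interpretation of $\mathsf{Gr(P)}$ assigns truth values to ground atoms of $U_{\mathsf{P},o}$ (ground $\mathsf{E}_1\approx\mathsf{E}_2$ is true iff syntactic identity); it is a model if whenever all body atoms of a formula of $\mathsf{Gr(P)}$ are true the head is true. $\mathcal{M}_\mathsf{Gr(P)}$ is the least model. Semantic domains: $[\![\iota]\!]=U_{\mathsf{P},\iota}$ with $\sqsubseteq_\iota$ equality; $[\![o]\!]=\{false,true\}$ with $false\le true$; $[\![\rho\to\pi]\!]$ = monotonic functions $[\![\rho]\!]\to[\![\pi]\!]$ with $f\sqsubseteq_{\rho\to\pi}g$ iff $f(d)\sqsubseteq_\pi g(d)$ for all $d$. Order $\preceq$ on ground terms: $\mathsf{E}\preceq_\iota\mathsf{E}'$ iff $\mathsf{E}=\mathsf{E}'$; $\mathsf{E}\preceq_o\mathsf{E}'$ iff $\mathcal{M}_\mathsf{Gr(P)}(\mathsf{E})\le\mathcal{M}_\mathsf{Gr(P)}(\mathsf{E}')$; $\mathsf{E}\preceq_{\rho\to\pi}\mathsf{E}'$ iff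 $\mathsf{E}\,\mathsf{D}\preceq_\pi\mathsf{E}'\,\mathsf{D}$ for all $\mathsf{D}\in U_{\mathsf{P},\rho}$. Semantic extension: for a ground term $\mathsf{E}$ of argument type $\rho$ and $d\in[\![\rho]\!]$, $d\lhd_\rho\mathsf{E}$ iff: ($\rho=\iota$) $d=\mathsf{E}$; ($\rho=o$) $d=\mathcal{M}_\mathsf{Gr(P)}(\mathsf{E})$; ($\rho=\rho'\to\pi$) for all $d'\in[\![\rho']\!]$ and $\mathsf{E}'\in U_{\mathsf{P},\rho'}$ with $d'\lhd_{\rho'}\mathsf{E}'$, it holds $d\,d'\lhd_\pi\mathsf{E}\,\mathsf{E}'$. -}

module Defs where

open import Data.Nat using (ℕ; suc)
open import Data.Bool using (Bool; true; false) renaming (_≤_ to _≤ᵇ_)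
open import Data.List using (List; []; _∷_; _++_; replicate)
open import Data.List.Membership.Propositional using (_∈_)
open import Data.List.Relation.Unary.All using (All; []; _∷_) renaming (lookup to lookupAll)
open import Data.List.Relation.Unary.Any using (here; there)
open import Data.Vec using (Vec; []; _∷_)
open import Data.Product using (Σ; _×_; _,_; proj₁)
open import Relation.Binary.PropositionalEquality using (_≡_)
open import Data.Sum using (_⊎_)
open import Data.Empty using (⊥)

-- Types
-- argument types  ρ ::= ι | π      predicate types  π ::= o | ρ → π
-- (functional types ι^n → ι only occur as types of function symbols,
--  represented below by their arity.)

mutual
  data AType : Set where
    ι  : AType
    pr : PType → AType

  data PType : Set where
    o   : PType
    _⇒_ : AType → PType → PType

infixr 20 _⇒_

arrows : List AType → PType → PType
arrows []       π = π
arrows (ρ ∷ ρs) π = ρ ⇒ arrows ρs π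

-- Signature: the predicate constants (of every predicate type), the
-- individual constants and the function symbols (Fun n has arity n+1 ≥ 1).

record Signature : Set₁ where
  field
    PCon : PType → Set
    ICon : Set
    Fun  : ℕ → Set
open Signature public

module _ (S : Signature) where

  data Term (Γ : List AType) : AType → Set where
    var  : ∀ {ρ} → ρ ∈ Γ → Term Γ ρ
    icon : ICon S → Term Γ ι
    pcon : ∀ {π} → PCon S π → Term Γ (pr π)
    fapp : ∀ {n} → Fun S n → Vec (Term Γ ι) (suc n) → Term Γ ι
    app  : ∀ {ρ π} → Term Γ (pr (ρ ⇒ π)) → Term Γ ρ → Term Γ (pr π)

  data OExpr (Γ : List AType) : Set where
    atom : Term Γ (pr o) → OExpr Γ
    _≈_  : Term Γ ι → Term Γ ι → OExpr Γ

  U : AType → Set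
  U ρ = Term [] ρ

  GSubst : List AType → Set
  GSubst Γ = All U Γ

  mutual
    substT : ∀ {Γ ρ} → GSubst Γ → Term Γ ρ → U ρ
    substT θ (var x)     = lookupAll θ x
    substT θ (icon c)    = icon c
    substT θ (pcon p)    = pcon p
    substT θ (fapp f ts) = fapp f (substV θ ts)
    substT θ (app t u)   = app (substT θ t) (substT θ u)

    substV : ∀ {Γ n} → GSubst Γ → Vec (Term Γ ι) n → Vec (U ι) n
    substV θ []       = []
    substV θ (t ∷ ts) = substT θ t ∷ substV θ ts

  substE : ∀ {Γ} → GSubst Γ → OExpr Γ → OExpr []
  substE θ (atom t) = atom (substT θ t)
  substE θ (a ≈ b)  = substT θ a ≈ substT θ b

  -- A definitional clause  p V₁ ⋯ Vₙ ← E₁,…,Eₘ : the head variables are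
  -- the (automatically pairwise distinct) first n variables of the
  -- context, of types args; the body may additionally use `extra`
  -- individual variables.
  record Clause : Set where
    field
      args  : List AType
      extra : ℕ
      pred  : PCon S (arrows args o)
      body  : List (OExpr (args ++ replicate extra ι))
  open Clause public

  Program : Set
  Program = List Clause

  headApp : ∀ (ρs : List AType) {Δ π} → U (pr (arrows ρs π)) → GSubst (ρs ++ Δ) → U (pr π)
  headApp []       t θ       = t
  headApp (ρ ∷ ρs) t (d ∷ θ) = headApp ρs (app t d) θ

  groundHead : (c : Clause) → GSubst (args c ++ replicate (extra c) ι) → U (pr o)
  groundHead c θ = headApp (args c) (pcon (pred c)) θ

  Interp : Set
  Interp = U (pr o) → Bool

  -- truth of a ground body expression (≈ is syntactic identity)
  True : Interp → OExpr [] → Set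
  True I (atom t) = I t ≡ true
  True I (a ≈ b)  = a ≡ b

  IsModel : Program → Interp → Set
  IsModel P I = ∀ c → c ∈ P → (θ : GSubst (args c ++ replicate (extra c) ι)) →
                All (λ e → True I (substE θ e)) (body c) → I (groundHead c θ) ≡ true

  -- M_Gr(P)(E) = true : the ≤-minimum model of Gr(P) (the intersection
  -- of all models) makes the ground atom E true.
  MTrue : Program → U (pr o) → Set
  MTrue P E = ∀ (I : Interp) → IsModel P I → I E ≡ true

  mutual
    ⟦_⟧ : AType → Set
    ⟦ ι ⟧    = U ι
    ⟦ pr π ⟧ = ⟦ π ⟧ᴾ

    ⟦_⟧ᴾ : PType → Set
    ⟦ o ⟧ᴾ     = Bool
    ⟦ ρ ⇒ π ⟧ᴾ = Σ (⟦ ρ ⟧ → ⟦ π ⟧ᴾ) (λ f → ∀ x y → ⊑ ρ x y → ⊑ᴾ π (f x) (f y))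

    ⊑ : (ρ : AType) → ⟦ ρ ⟧ → ⟦ ρ ⟧ → Set
    ⊑ ι      d e = d ≡ e
    ⊑ (pr π) d e = ⊑ᴾ π d e

    ⊑ᴾ : (π : PType) → ⟦ π ⟧ᴾ → ⟦ π ⟧ᴾ → Set
    ⊑ᴾ o       d e = d ≤ᵇ e
    ⊑ᴾ (ρ ⇒ π) f g = ∀ d → ⊑ᴾ π (proj₁ f d) (proj₁ g d)

  ⪯ : Program → (ρ : AType) → U ρ → U ρ → Set
  ⪯ P ι            E E' = E ≡ E'
  ⪯ P (pr o)       E E' = MTrue P E → MTrue P E'   -- M(E) ≤ M(E')
  ⪯ P (pr (ρ ⇒ π)) E E' = ∀ (D : U ρ) → ⪯ P (pr π) (app E D) (app E' D)

  ◁ : Program → (ρ : AType) → ⟦ ρ ⟧ → U ρ → Set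
  ◁ P ι            d E = d ≡ E
  ◁ P (pr o)       d E = (d ≡ true → MTrue P E) × (MTrue P E → d ≡ true)  -- d = M(E)
  ◁ P (pr (ρ ⇒ π)) d E = ∀ (d' : ⟦ ρ ⟧) (E' : U ρ) → ◁ P ρ d' E' → ◁ P (pr π) (proj₁ d d') (app E E')

-- Classical logic (the paper's ambient metatheory), as a hypothesis.
ExcludedMiddle : Set₁
ExcludedMiddle = (A : Set) → A ⊎ (A → ⊥)

{-# OPTIONS --safe #-}
-- For (2) at ρ → π, apply both sides to an arbitrary
-- ground D : ρ, which has a representative by (1). For (1) at ρ → π, E is represented by
-- the function sending d to the join of the representatives of E D over all D represented
-- by some d' ⊑ d: by (2) at ρ each such D satisfies D ⪯ D' whenever d ◁ D', and
-- application is monotone, D ⪯ D' implying E D ⪯ E D'.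
-- That monotonicity is the syntactic core. It comes from a logical relation ≲ n on ground
-- terms, indexed by the height of derivations in Gr(P): every term is related to itself,
-- for predicate constants by strong induction on n, and the least model consists exactly
-- of the derivable atoms. Excluded middle forms the joins and decides derivability.
module Submission where

open import Defs
open import Data.Bool using (Bool; true; false; b≤b; f≤t) renaming (_≤_ to _≤ᵇ_)
import Data.Bool.Properties as Bool
open import Data.Empty using (⊥-elim)
open import Data.List using (List; []; _∷_; _++_; replicate)
open import Data.List.Membership.Propositional using (_∈_)
open import Data.List.Relation.Unary.All using (All; []; _∷_)
open import Data.List.Relation.Unary.Any using (here; there)
open import Data.Nat using (ℕ; zero; suc; _≤_; _<_; _⊔_; s≤s)
open import Data.Nat.Induction using (<-rec)
open import Data.Nat.Properties using (≤-refl; ≤-trans; n≤1+n; <-≤-trans; m≤m⊔n; m≤n⊔m)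
open import Data.Product using (Σ; _×_; _,_; proj₁; proj₂)
open import Data.Sum using (inj₁; inj₂)
open import Data.Vec using (Vec; []; _∷_)
open import Function using (_∘_)
open import Relation.Binary.PropositionalEquality using (_≡_; refl; sym; trans; cong; cong₂)

≤ᵇ-true : ∀ {a b} → a ≤ᵇ b → a ≡ true → b ≡ true
≤ᵇ-true b≤b a≡true = a≡true
≤ᵇ-true f≤t ()

module Classical (lem : ExcludedMiddle) where

  ⌊_⌋ : Set → Bool
  ⌊ A ⌋ with lem A
  ... | inj₁ _ = true
  ... | inj₂ _ = false

  ⌊⌋-sound : ∀ {A} → ⌊ A ⌋ ≡ true → A
  ⌊⌋-sound {A} h with lem A
  ... | inj₁ a = a
  ⌊⌋-sound {A} () | inj₂ _

  ⌊⌋-complete : ∀ {A} → A → ⌊ A ⌋ ≡ true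
  ⌊⌋-complete {A} a with lem A
  ... | inj₁ _  = refl
  ... | inj₂ ¬a = ⊥-elim (¬a a)

  ⌊⌋-mono : ∀ {A B} → (A → B) → ⌊ A ⌋ ≤ᵇ ⌊ B ⌋
  ⌊⌋-mono {A} {B} f with lem A | lem B
  ... | inj₁ _ | inj₁ _  = b≤b
  ... | inj₁ a | inj₂ ¬b = ⊥-elim (¬b (f a))
  ... | inj₂ _ | inj₁ _  = f≤t
  ... | inj₂ _ | inj₂ _  = b≤b

module _ (S : Signature) where

  Dom : AType → Set
  Dom = ⟦_⟧ S

  Domᴾ : PType → Set
  Domᴾ = ⟦_⟧ᴾ S

  ⊑ᴾ-refl : ∀ π (d : Domᴾ π) → ⊑ᴾ S π d d
  ⊑ᴾ-refl o       b = b≤b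
  ⊑ᴾ-refl (ρ ⇒ π) f = λ x → ⊑ᴾ-refl π (proj₁ f x)

  ⊑-refl : ∀ ρ (d : Dom ρ) → ⊑ S ρ d d
  ⊑-refl ι      d = refl
  ⊑-refl (pr π) d = ⊑ᴾ-refl π d

  ⊑ᴾ-trans : ∀ π {a b c : Domᴾ π} → ⊑ᴾ S π a b → ⊑ᴾ S π b c → ⊑ᴾ S π a c
  ⊑ᴾ-trans o       a≤b b≤c = Bool.≤-trans a≤b b≤c
  ⊑ᴾ-trans (ρ ⇒ π) a⊑b b⊑c = λ x → ⊑ᴾ-trans π (a⊑b x) (b⊑c x)

  ⊑-trans : ∀ ρ {a b c : Dom ρ} → ⊑ S ρ a b → ⊑ S ρ b c → ⊑ S ρ a c
  ⊑-trans ι      a≡b b≡c = trans a≡b b≡c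
  ⊑-trans (pr π) a⊑b b⊑c = ⊑ᴾ-trans π a⊑b b⊑c

  module Suprema (lem : ExcludedMiddle) where
    open Classical lem

    mutual
      ⨆ : ∀ π (I : Set) → (I → Domᴾ π) → Domᴾ π
      ⨆ o       I g = ⌊ Σ I (λ i → g i ≡ true) ⌋
      ⨆ (ρ ⇒ π) I g =
        (λ x → ⨆ π I (λ i → proj₁ (g i) x)) ,
        (λ x y x⊑y → ⨆-mono π (λ i → proj₁ (g i) x) (λ i → proj₁ (g i) y) (λ i → i)
                        (λ i → proj₂ (g i) x y x⊑y))

      ⨆-mono : ∀ π {I J : Set} (g : I → Domᴾ π) (h : J → Domᴾ π) (φ : I → J) →
               (∀ i → ⊑ᴾ S π (g i) (h (φ i))) → ⊑ᴾ S π (⨆ π I g) (⨆ π J h)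
      ⨆-mono o       g h φ g≤h = ⌊⌋-mono (λ (i , gi) → φ i , ≤ᵇ-true (g≤h i) gi)
      ⨆-mono (ρ ⇒ π) g h φ g⊑h = λ x →
        ⨆-mono π (λ i → proj₁ (g i) x) (λ j → proj₁ (h j) x) φ (λ i → g⊑h i x)

  module _ (P : Program S) where

    ClauseSubst : Clause S → Set
    ClauseSubst c = GSubst S (args c ++ replicate (extra c) ι)

    mutual
      data Derivable : ℕ → U S (pr o) → Set where
        by-clause : ∀ {n} c → c ∈ P → (θ : ClauseSubst c) →
                    All (Holds n ∘ substE S θ) (body c) → Derivable (suc n) (groundHead S c θ)

      Holds : ℕ → OExpr S [] → Set
      Holds n (atom A) = Derivable n A
      Holds n (a ≈ b)  = a ≡ b

    mutual
      derivable-mono : ∀ {m n A} → m ≤ n → Derivable m A → Derivable n A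
      derivable-mono (s≤s m≤n) (by-clause c c∈P θ hs) =
        by-clause c c∈P θ (holdsAll-mono m≤n (body c) hs)

      holdsAll-mono : ∀ {m n Γ} {θ : GSubst S Γ} → m ≤ n → (es : List (OExpr S Γ)) →
                      All (Holds m ∘ substE S θ) es → All (Holds n ∘ substE S θ) es
      holdsAll-mono m≤n []             []       = []
      holdsAll-mono m≤n (atom t ∷ es)  (d ∷ hs) =
        derivable-mono m≤n d ∷ holdsAll-mono m≤n es hs
      holdsAll-mono m≤n ((a ≈ b) ∷ es) (p ∷ hs) = p ∷ holdsAll-mono m≤n es hs

    ≲ : ℕ → (ρ : AType) → U S ρ → U S ρ → Set
    ≲ n ι            A B = A ≡ B
    ≲ n (pr o)       A B = Derivable n A → MTrue S P B
    ≲ n (pr (ρ ⇒ π)) A B =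
      ∀ m → m ≤ n → ∀ D D' → ≲ m ρ D D' → ≲ m (pr π) (app A D) (app B D')

    ≲-antitone : ∀ ρ {m n A B} → m ≤ n → ≲ n ρ A B → ≲ m ρ A B
    ≲-antitone ι            m≤n A≡B = A≡B
    ≲-antitone (pr o)       m≤n A≲B = A≲B ∘ derivable-mono m≤n
    ≲-antitone (pr (ρ ⇒ π)) m≤n A≲B = λ k k≤m → A≲B k (≤-trans k≤m m≤n)

    data ≲ˢ (n : ℕ) : ∀ {Γ} → GSubst S Γ → GSubst S Γ → Set where
      []  : ≲ˢ n [] []
      _∷_ : ∀ {ρ Γ d d'} {θ θ' : GSubst S Γ} →
            ≲ n ρ d d' → ≲ˢ n θ θ' → ≲ˢ n {ρ ∷ Γ} (d ∷ θ) (d' ∷ θ')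

    ≲ˢ-antitone : ∀ {m n Γ} {θ θ' : GSubst S Γ} → m ≤ n → ≲ˢ n θ θ' → ≲ˢ m θ θ'
    ≲ˢ-antitone m≤n []                  = []
    ≲ˢ-antitone m≤n (_∷_ {ρ} d≲d' θ≲θ') = ≲-antitone ρ m≤n d≲d' ∷ ≲ˢ-antitone m≤n θ≲θ'

    ≲ˢ-replicate-ι : ∀ {n} k (θ : GSubst S (replicate k ι)) → ≲ˢ n θ θ
    ≲ˢ-replicate-ι zero    []      = []
    ≲ˢ-replicate-ι (suc k) (d ∷ θ) = refl ∷ ≲ˢ-replicate-ι k θ

    ≲ˢ-lookup : ∀ {n Γ ρ} {θ θ' : GSubst S Γ} → ≲ˢ n θ θ' → (x : ρ ∈ Γ) →
                ≲ n ρ (substT S θ (var x)) (substT S θ' (var x))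
    ≲ˢ-lookup (d≲d' ∷ _)    (here refl) = d≲d'
    ≲ˢ-lookup (_    ∷ θ≲θ') (there x)   = ≲ˢ-lookup θ≲θ' x

    ConstantsRefl : ℕ → Set
    ConstantsRefl n = ∀ π (p : PCon S π) → ≲ n (pr π) (pcon p) (pcon p)

    mutual
      ≲-subst : ∀ {n Γ ρ} (t : Term S Γ ρ) {θ θ' : GSubst S Γ} →
                ConstantsRefl n → ≲ˢ n θ θ' → ≲ n ρ (substT S θ t) (substT S θ' t)
      ≲-subst (var x)      pcon-refl θ≲θ' = ≲ˢ-lookup θ≲θ' x
      ≲-subst (icon c)     pcon-refl θ≲θ' = refl
      ≲-subst (pcon {π} p) pcon-refl θ≲θ' = pcon-refl π p
      ≲-subst (fapp f ts)  pcon-refl θ≲θ' = cong (fapp f) (≲-substV ts pcon-refl θ≲θ')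
      ≲-subst {n} (app t u) {θ} {θ'} pcon-refl θ≲θ' =
        ≲-subst t pcon-refl θ≲θ' n ≤-refl (substT S θ u) (substT S θ' u) (≲-subst u pcon-refl θ≲θ')

      ≲-substV : ∀ {n Γ k} (ts : Vec (Term S Γ ι) k) {θ θ' : GSubst S Γ} →
                 ConstantsRefl n → ≲ˢ n θ θ' → substV S θ ts ≡ substV S θ' ts
      ≲-substV []       pcon-refl θ≲θ' = refl
      ≲-substV (t ∷ ts) pcon-refl θ≲θ' =
        cong₂ _∷_ (≲-subst t pcon-refl θ≲θ') (≲-substV ts pcon-refl θ≲θ')

    body-true : ∀ {n Γ} {θ θ' : GSubst S Γ} (I : Interp S) → IsModel S P I →
                ConstantsRefl n → ≲ˢ n θ θ' → (es : List (OExpr S Γ)) →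
                All (Holds n ∘ substE S θ) es → All (True S I ∘ substE S θ') es
    body-true I I-model pcon-refl θ≲θ' []             []       = []
    body-true I I-model pcon-refl θ≲θ' (atom t ∷ es)  (d ∷ hs) =
      ≲-subst t pcon-refl θ≲θ' d I I-model ∷ body-true I I-model pcon-refl θ≲θ' es hs
    body-true I I-model pcon-refl θ≲θ' ((a ≈ b) ∷ es) (a≡b ∷ hs) =
      trans (sym (≲-subst a pcon-refl θ≲θ')) (trans a≡b (≲-subst b pcon-refl θ≲θ')) ∷
      body-true I I-model pcon-refl θ≲θ' es hs

    data Spine (n : ℕ) : ∀ {π} → U S (pr π) → U S (pr π) → Set where
      spine-pcon : ∀ {π} (p : PCon S π) → Spine n (pcon p) (pcon p)
      spine-app  : ∀ {ρ π} {A B : U S (pr (ρ ⇒ π))} {D D' : U S ρ} →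
                   Spine n A B → ≲ n ρ D D' → Spine n (app A D) (app B D')

    spine-antitone : ∀ {m n π} {A B : U S (pr π)} → m ≤ n → Spine n A B → Spine m A B
    spine-antitone m≤n (spine-pcon p)           = spine-pcon p
    spine-antitone m≤n (spine-app {ρ} A~B D≲D') =
      spine-app (spine-antitone m≤n A~B) (≲-antitone ρ m≤n D≲D')

    spine-headApp : ∀ {n} ρs {Δ π} (t : U S (pr (arrows ρs π))) (θ : GSubst S (ρs ++ Δ))
                    {B : U S (pr π)} → (∀ (θΔ : GSubst S Δ) → ≲ˢ n θΔ θΔ) →
                    Spine n (headApp S ρs t θ) B →
                    Σ (U S (pr (arrows ρs π))) λ t' → Σ (GSubst S (ρs ++ Δ)) λ θ' →
                      Spine n t t' × ≲ˢ n θ θ' × B ≡ headApp S ρs t' θ'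
    spine-headApp []       t θ {B} Δ-refl t~B = B , θ , t~B , Δ-refl θ , refl
    spine-headApp (ρ ∷ ρs) t (d ∷ θ) Δ-refl spine
      with spine-headApp ρs (app t d) θ Δ-refl spine
    ... | _ , θ' , spine-app {B = t'} {D' = d'} t~t' d≲d' , θ≲θ' , B≡ =
      t' , d' ∷ θ' , t~t' , d≲d' ∷ θ≲θ' , B≡

    -- The clause deriving A has its body derived at a smaller height, where constants are
    -- already known to be related to themselves.
    spine⇒≲ : ∀ n → (∀ {k} → k < n → ConstantsRefl k) →
              ∀ π {A B : U S (pr π)} → Spine n A B → ≲ n (pr π) A B
    spine⇒≲ .(suc k) below o spine (by-clause {k} c c∈P θ hs)
      with spine-headApp (args c) (pcon (pred c)) θ (≲ˢ-replicate-ι (extra c)) spine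
    ... | _ , θ' , spine-pcon _ , θ≲θ' , refl = λ I I-model →
      I-model c c∈P θ'
        (body-true I I-model (below ≤-refl) (≲ˢ-antitone (n≤1+n k) θ≲θ') (body c) hs)
    spine⇒≲ n below (ρ ⇒ π) spine m m≤n D D' D≲D' =
      spine⇒≲ m (λ k<m → below (<-≤-trans k<m m≤n)) π
        (spine-app (spine-antitone m≤n spine) D≲D')

    constants-refl : ∀ n → ConstantsRefl n
    constants-refl = <-rec ConstantsRefl (λ n below π p → spine⇒≲ n below π (spine-pcon p))

    ≲-refl : ∀ n ρ (A : U S ρ) → ≲ n ρ A A
    ≲-refl n _ (var ())
    ≲-refl n _ (icon c)      = refl
    ≲-refl n _ (pcon {π} p)  = constants-refl n π p
    ≲-refl n _ (fapp f ts)   = refl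
    ≲-refl n _ (app {ρ} t u) = ≲-refl n _ t n ≤-refl u u (≲-refl n ρ u)

    ≲-⪯-trans : ∀ ρ {n} {A B C : U S ρ} → ≲ n ρ A B → ⪯ S P ρ B C → ≲ n ρ A C
    ≲-⪯-trans ι            A≡B B≡C = trans A≡B B≡C
    ≲-⪯-trans (pr o)       A≲B B⪯C = B⪯C ∘ A≲B
    ≲-⪯-trans (pr (ρ ⇒ π)) A≲B B⪯C m m≤n D D' D≲D' =
      ≲-⪯-trans (pr π) (A≲B m m≤n D D' D≲D') (B⪯C D')

    module _ (lem : ExcludedMiddle) where
      open Classical lem
      open Suprema lem

      isDerivable : Interp S
      isDerivable A = ⌊ Σ ℕ (λ n → Derivable n A) ⌋

      holdsAll-bound : ∀ {Γ} {θ : GSubst S Γ} (es : List (OExpr S Γ)) →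
                       All (True S isDerivable ∘ substE S θ) es →
                       Σ ℕ λ n → All (Holds n ∘ substE S θ) es
      holdsAll-bound []             []       = zero , []
      holdsAll-bound (atom t ∷ es)  (h ∷ hs) with ⌊⌋-sound h | holdsAll-bound es hs
      ... | m , d | n , ds =
        m ⊔ n , derivable-mono (m≤m⊔n m n) d ∷ holdsAll-mono (m≤n⊔m m n) es ds
      holdsAll-bound ((a ≈ b) ∷ es) (a≡b ∷ hs) with holdsAll-bound es hs
      ... | n , ds = n , a≡b ∷ ds

      isDerivable-model : IsModel S P isDerivable
      isDerivable-model c c∈P θ hs =
        let n , ds = holdsAll-bound (body c) hs in ⌊⌋-complete (suc n , by-clause c c∈P θ ds)

      MTrue⇒derivable : ∀ {A} → MTrue S P A → Σ ℕ λ n → Derivable n A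
      MTrue⇒derivable A-true = ⌊⌋-sound (A-true isDerivable isDerivable-model)

      ≲⇒⪯ : ∀ ρ {A B : U S ρ} → (∀ n → ≲ n ρ A B) → ⪯ S P ρ A B
      ≲⇒⪯ ι            A≲B = A≲B zero
      ≲⇒⪯ (pr o)       A≲B A-true = let n , d = MTrue⇒derivable A-true in A≲B n d
      ≲⇒⪯ (pr (ρ ⇒ π)) A≲B D = ≲⇒⪯ (pr π) (λ n → A≲B n n ≤-refl D D (≲-refl n ρ D))

      app-monoʳ-⪯ : ∀ ρ π (E : U S (pr (ρ ⇒ π))) {D D' : U S ρ} →
                    ⪯ S P ρ D D' → ⪯ S P (pr π) (app E D) (app E D')
      app-monoʳ-⪯ ρ π E {D} D⪯D' =
        ≲⇒⪯ (pr π) (λ n → ≲-refl n _ E n ≤-refl _ _ (≲-⪯-trans ρ (≲-refl n ρ D) D⪯D'))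

      ◁-⨆ : ∀ π {I : Set} (g : I → Domᴾ π) (Es : I → U S (pr π)) (E : U S (pr π)) →
            (∀ i → ◁ S P (pr π) (g i) (Es i)) → (∀ i → ⪯ S P (pr π) (Es i) E) →
            (i₀ : I) → ◁ S P (pr π) (g i₀) E → ◁ S P (pr π) (⨆ π I g) E
      ◁-⨆ o g Es E g◁Es Es⪯E i₀ gi₀◁E =
        (λ ⨆g≡true → let i , gi≡true = ⌊⌋-sound ⨆g≡true in
                      Es⪯E i (proj₁ (g◁Es i) gi≡true)) ,
        (λ E-true → ⌊⌋-complete (i₀ , proj₂ gi₀◁E E-true))
      ◁-⨆ (ρ ⇒ π) g Es E g◁Es Es⪯E i₀ gi₀◁E d D d◁D =
        ◁-⨆ π (λ i → proj₁ (g i) d) (λ i → app (Es i) D) (app E D)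
          (λ i → g◁Es i d D d◁D) (λ i → Es⪯E i D) i₀ (gi₀◁E d D d◁D)

      mutual
        ◁-witness : ∀ ρ (E : U S ρ) → Σ (Dom ρ) λ e → ◁ S P ρ e E
        ◁-witness ι      E = E , refl
        ◁-witness (pr π) E = ◁-witnessᴾ π E

        ◁-witnessᴾ : ∀ π (E : U S (pr π)) → Σ (Domᴾ π) λ e → ◁ S P (pr π) e E
        ◁-witnessᴾ o       E = ⌊ MTrue S P E ⌋ , ⌊⌋-sound , ⌊⌋-complete
        ◁-witnessᴾ (ρ ⇒ π) E = (f , f-mono) , f◁E
          where
            Below : Dom ρ → Set
            Below d = Σ (U S ρ) λ D → Σ (Dom ρ) λ d' → ◁ S P ρ d' D × ⊑ S ρ d' d

            value : ∀ {d} → Below d → Domᴾ π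
            value (D , _) = proj₁ (◁-witnessᴾ π (app E D))

            f : Dom ρ → Domᴾ π
            f d = ⨆ π (Below d) value

            f-mono : ∀ d₁ d₂ → ⊑ S ρ d₁ d₂ → ⊑ᴾ S π (f d₁) (f d₂)
            f-mono d₁ d₂ d₁⊑d₂ = ⨆-mono π value value
              (λ (D , d' , d'◁D , d'⊑d₁) → D , d' , d'◁D , ⊑-trans ρ d'⊑d₁ d₁⊑d₂)
              (λ i → ⊑ᴾ-refl π (value i))

            f◁E : ∀ d D → ◁ S P ρ d D → ◁ S P (pr π) (f d) (app E D)
            f◁E d D d◁D = ◁-⨆ π value (λ (D' , _) → app E D') (app E D)
              (λ (D' , _) → proj₂ (◁-witnessᴾ π (app E D')))
              (λ (D' , d' , d'◁D' , d'⊑d) →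
                 app-monoʳ-⪯ ρ π E (◁-⊑⇒⪯ ρ D' d' d D d'◁D' d◁D d'⊑d))
              (D , d , d◁D , ⊑-refl ρ d) (proj₂ (◁-witnessᴾ π (app E D)))

        ◁-⊑⇒⪯ : ∀ ρ (E : U S ρ) (e e' : Dom ρ) (E' : U S ρ) →
                ◁ S P ρ e E → ◁ S P ρ e' E' → ⊑ S ρ e e' → ⪯ S P ρ E E'
        ◁-⊑⇒⪯ ι      E e e' E' e≡E e'≡E' e≡e' = trans (sym e≡E) (trans e≡e' e'≡E')
        ◁-⊑⇒⪯ (pr π) E e e' E' e◁E e'◁E' e⊑e' = ◁-⊑ᴾ⇒⪯ π E e e' E' e◁E e'◁E' e⊑e'

        ◁-⊑ᴾ⇒⪯ : ∀ π (E : U S (pr π)) (e e' : Domᴾ π) (E' : U S (pr π)) →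
                 ◁ S P (pr π) e E → ◁ S P (pr π) e' E' → ⊑ᴾ S π e e' → ⪯ S P (pr π) E E'
        ◁-⊑ᴾ⇒⪯ o       E e e' E' e◁E e'◁E' e≤e' E-true =
          proj₁ e'◁E' (≤ᵇ-true e≤e' (proj₂ e◁E E-true))
        ◁-⊑ᴾ⇒⪯ (ρ ⇒ π) E e e' E' e◁E e'◁E' e⊑e' D =
          let d , d◁D = ◁-witness ρ D in
          ◁-⊑ᴾ⇒⪯ π (app E D) (proj₁ e d) (proj₁ e' d) (app E' D)
            (e◁E d D d◁D) (e'◁E' d D d◁D) (e⊑e' d)

lemma5 : (S : Signature) (P : Program S) → ExcludedMiddle →
         (ρ : AType) (E : U S ρ) →
         Σ (⟦_⟧ S ρ) (λ e → ◁ S P ρ e E)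
         × (∀ (e e' : ⟦_⟧ S ρ) (E' : U S ρ) →
              ◁ S P ρ e E → ◁ S P ρ e' E' → ⊑ S ρ e e' → ⪯ S P ρ E E')
lemma5 S P lem ρ E = ◁-witness S P lem ρ E , ◁-⊑⇒⪯ S P lem ρ E
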